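{- Let $L$ be an $h$-sorted lattice data structure of height $h$. Then (1) $J(K)\le 2$ for every proper key $K$ of $L$, and (2) $J(K)\le 4$ for every positive integer $K$ that is not a proper key of $L$.
   Context: Diagram of height $h$: cells $(r,c)$ of positive integers with $r+c\le h+4$; $r$ is the row (numbered bottom to top), $c$ the column (left to right). Diagonal $k$ ($1\le k\le h+3$) is the set of cells with $r+c=k+1$, numbered from head $(k,1)$ to tail $(1,k)$, its $j$-th cell being $(k+1-j,j)$. A lattice data structure (LDS) of height $h$ assigns to each cell an entry in $\{0,\infty\}\cup\mathbb{Z}_{>0}$ such that: (1) all cells of row $1$ and column $1$ contain $0$; (2) all cells of diagonal $h+3$ except head and tail contain $\infty$; (3) for some $0\le m\le h-1$, exactly the cells $(h+3-j,j)$ of diagonal $h+2$ with $h+2-m\le j\le h+1$ contain $\infty$; (4) all remaining cells contain pairwise distinct positive integers (proper keys); (5) proper keys are strictly increasing along each row (left to right), column (bottom to top) and diagonal (head to tail). Order convention: $0<n<\infty$. For a cell $C=(r,c)$: $D=(r-1,c)$, $DR=(r-1,c+1)$. SearchLDS($L,K$): start at $(h+1,2)$; repeatedly: entry $=K$ → stop; entry $=0$ → stop; else move to $DR$ (a "$d$" movement) if $K>$ entry, to $D$ (a "$D$" movement) if $K<$ entry. The search path of $K$ is the sequence of movements made until termination; $J(K)$ is the number of maximal blocks of consecutive identical movements in it. $L$ (with $h\ge 3$) is $h$-sorted if for every $s$ with $4\le s\le h+2$, the first proper key of diagonal $s$ (counting from the head) is greater than the last proper key of diagonal $s-1$. -}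

module Defs where

open import Data.Nat using (ℕ; zero; suc; _+_; _∸_; _≤_; _<_; _≡ᵇ_; _<ᵇ_)
open import Data.Bool using (Bool; true; false; if_then_else_)
open import Data.List using (List; []; _∷_)
open import Data.Product using (Σ; _×_; ∃; ∃-syntax)
open import Relation.Binary.PropositionalEquality using (_≡_)
open import Relation.Nullary using (¬_)
open import Function.Bundles using (_⇔_)

-- Entries of a lattice data structure: 0, ∞, or a natural number (proper key).
data Entry : Set where
  nil : Entry
  inf : Entry
  key : ℕ → Entry

-- An assignment of entries to cells (r , c); only cells of the diagram matter.
Assignment : Set
Assignment = ℕ → ℕ → Entry

InDiagram : ℕ → ℕ → ℕ → Set
InDiagram h r c = 1 ≤ r × 1 ≤ c × r + c ≤ h + 4

record IsLDS (h : ℕ) (L : Assignment) : Set where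
  field
    row1 : ∀ c → InDiagram h 1 c → L 1 c ≡ nil
    col1 : ∀ r → InDiagram h r 1 → L r 1 ≡ nil
    -- (2) diagonal h+3 (r + c = h + 4) except head and tail contains ∞
    diag-top : ∀ r c → 2 ≤ r → 2 ≤ c → r + c ≡ h + 4 → L r c ≡ inf
    -- (3) the parameter m and the ∞ cells on diagonal h+2 (r + c = h + 3);
    --     the j-th cell of that diagonal is in column c = j
    m : ℕ
    m<h : m < h
    diag-second : ∀ r c → 2 ≤ r → 2 ≤ c → r + c ≡ h + 3 →
                  (L r c ≡ inf) ⇔ (h + 2 ≤ c + m)
    remaining : ∀ r c → 2 ≤ r → 2 ≤ c → r + c ≤ h + 3 →
                ¬ (r + c ≡ h + 3 × h + 2 ≤ c + m) →
                ∃[ n ] (1 ≤ n × L r c ≡ key n)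
    distinct : ∀ r c r' c' n → InDiagram h r c → InDiagram h r' c' →
               L r c ≡ key n → L r' c' ≡ key n → r ≡ r' × c ≡ c'
    rowInc : ∀ r c c' a b → InDiagram h r c → InDiagram h r c' →
             c < c' → L r c ≡ key a → L r c' ≡ key b → a < b
    colInc : ∀ r r' c a b → InDiagram h r c → InDiagram h r' c →
             r < r' → L r c ≡ key a → L r' c ≡ key b → a < b
    diagInc : ∀ r c r' c' a b → InDiagram h r c → InDiagram h r' c' →
              r + c ≡ r' + c' → c < c' →
              L r c ≡ key a → L r' c' ≡ key b → a < b

IsProperKey : ℕ → Assignment → ℕ → Set
IsProperKey h L K = Σ ℕ λ r → Σ ℕ λ c → InDiagram h r c × L r c ≡ key K

-- The j-th cell of diagonal k is (k + 1 - j , j), 1 ≤ j ≤ k.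
-- a is the first proper key of diagonal k (counting from the head).
FirstKeyOfDiag : Assignment → ℕ → ℕ → Set
FirstKeyOfDiag L k a =
  Σ ℕ λ j → 1 ≤ j × j ≤ k × L (k + 1 ∸ j) j ≡ key a ×
    (∀ j' b → 1 ≤ j' → j' < j → ¬ (L (k + 1 ∸ j') j' ≡ key b))

LastKeyOfDiag : Assignment → ℕ → ℕ → Set
LastKeyOfDiag L k a =
  Σ ℕ λ j → 1 ≤ j × j ≤ k × L (k + 1 ∸ j) j ≡ key a ×
    (∀ j' b → j < j' → j' ≤ k → ¬ (L (k + 1 ∸ j') j' ≡ key b))

HSorted : ℕ → Assignment → Set
HSorted h L = 3 ≤ h ×
  (∀ s → 4 ≤ s → s ≤ h + 2 → ∀ a b →
     FirstKeyOfDiag L s a → LastKeyOfDiag L (s ∸ 1) b → b < a)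

-- Movements: d = move to DR, D = move down.
data Move : Set where
  d D : Move

-- Search path of K starting at cell (r , c); recursion on the row
-- (every movement decreases the row by one; row index 0 never occurs
-- in practice since row 1 contains 0).
searchFrom : Assignment → ℕ → ℕ → ℕ → List Move
searchFrom L K zero c = []
searchFrom L K (suc r) c with L (suc r) c
... | nil = []
... | inf = D ∷ searchFrom L K r c
... | key n = if K ≡ᵇ n then []
              else (if n <ᵇ K then d ∷ searchFrom L K r (suc c)
                    else D ∷ searchFrom L K r c)

searchPath : ℕ → Assignment → ℕ → List Move
searchPath h L K = searchFrom L K (h + 1) 2

sameMove : Move → Move → Bool
sameMove d d = true
sameMove D D = true
sameMove _ _ = false

blocks : List Move → ℕ
blocks [] = 0
blocks (x ∷ []) = 1
blocks (x ∷ y ∷ xs) = (if sameMove x y then 0 else 1) + blocks (y ∷ xs)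

J : ℕ → Assignment → ℕ → ℕ
J h L K = blocks (searchPath h L K)

-- The search starts in column 2 on diagonal h + 2; a d-move stays on the current diagonal and a
-- D-move drops to the next lower one. The column-2 entry of a diagonal is its first proper key, so by
-- h-sortedness it exceeds every key on all lower diagonals. Hence the search descends column 2 until
-- it reaches the diagonal of K (if K is a key) or a column-2 entry below K. If K is a key it then
-- walks along its diagonal straight to K (path D*d*). Otherwise every key on the next lower diagonal
-- is below K, so it walks along the diagonal until it meets ∞ or an entry above K, drops once, and
-- walks along the lower diagonal down to row 1 (path D*d*Dd*).
module Submission where

open import Defs
open import Data.Nat using (ℕ; zero; suc; _+_; _∸_; _≤_; _<_; z≤n; s≤s; s≤s⁻¹; pred)
open import Data.Nat.Properties
open import Data.Bool using (true; false; T)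
open import Data.Bool.Properties using (T-≡)
open import Data.List using (List; []; _∷_; length)
open import Data.Product using (_×_; _,_; ∃-syntax; proj₁; proj₂; map₂)
open import Data.Sum using (_⊎_; inj₁; inj₂)
open import Data.Empty using (⊥-elim)
open import Relation.Nullary using (¬_; yes; no)
open import Relation.Binary using (tri<; tri≈; tri>)
open import Relation.Binary.PropositionalEquality hiding (J)
open import Function.Bundles using (Equivalence)

-- `Runs (p₁ ∷ ⋯ ∷ pₖ ∷ []) xs` says that xs lies in the language p₁* p₂* ⋯ pₖ*.
data Runs : List Move → List Move → Set where
  []   : ∀ {ps} → Runs ps []
  here : ∀ {p ps xs} → Runs (p ∷ ps) xs → Runs (p ∷ ps) (p ∷ xs)
  next : ∀ {p ps xs} → Runs ps xs → Runs (p ∷ ps) xs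

sameMove-refl : ∀ x → sameMove x x ≡ true
sameMove-refl d = refl
sameMove-refl D = refl

blocks-∷-≤ : ∀ x xs → blocks (x ∷ xs) ≤ suc (blocks xs)
blocks-∷-≤ x []       = s≤s z≤n
blocks-∷-≤ x (y ∷ xs) with sameMove x y
... | true  = n≤1+n _
... | false = ≤-refl

blocks-Runs   : ∀ {ps xs} → Runs ps xs → blocks xs ≤ length ps
blocks-∷-Runs : ∀ {p ps xs} → Runs (p ∷ ps) xs → blocks (p ∷ xs) ≤ length (p ∷ ps)

blocks-Runs []       = z≤n
blocks-Runs (here r) = blocks-∷-Runs r
blocks-Runs (next r) = m≤n⇒m≤1+n (blocks-Runs r)

blocks-∷-Runs []                 = s≤s z≤n
blocks-∷-Runs {p} (here r)       rewrite sameMove-refl p = blocks-∷-Runs r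
blocks-∷-Runs (next {xs = xs} r) = ≤-trans (blocks-∷-≤ _ xs) (s≤s (blocks-Runs r))

¬T⇒≡false : ∀ {b} → ¬ T b → b ≡ false
¬T⇒≡false {false} _  = refl
¬T⇒≡false {true}  ¬t = ⊥-elim (¬t _)

nil≢key : ∀ {n} → nil ≢ key n
nil≢key ()

inf≢key : ∀ {n} → inf ≢ key n
inf≢key ()

key-injective : ∀ {a b} → key a ≡ key b → a ≡ b
key-injective refl = refl

module _ (L : Assignment) (K : ℕ) {r c : ℕ} where

  search-nil : L (suc r) c ≡ nil → searchFrom L K (suc r) c ≡ []
  search-nil eq rewrite eq = refl

  search-inf : L (suc r) c ≡ inf → searchFrom L K (suc r) c ≡ D ∷ searchFrom L K r c
  search-inf eq rewrite eq = refl

  search-found : L (suc r) c ≡ key K → searchFrom L K (suc r) c ≡ []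
  search-found eq rewrite eq | Equivalence.to T-≡ (≡⇒≡ᵇ K K refl) = refl

  search-right : ∀ {n} → L (suc r) c ≡ key n → n < K →
                 searchFrom L K (suc r) c ≡ d ∷ searchFrom L K r (suc c)
  search-right {n} eq n<K
    rewrite eq | ¬T⇒≡false (λ t → >⇒≢ n<K (≡ᵇ⇒≡ K n t)) | Equivalence.to T-≡ (<⇒<ᵇ n<K) = refl

  search-down : ∀ {n} → L (suc r) c ≡ key n → K < n →
                searchFrom L K (suc r) c ≡ D ∷ searchFrom L K r c
  search-down {n} eq K<n
    rewrite eq | ¬T⇒≡false (λ t → <⇒≢ K<n (≡ᵇ⇒≡ K n t))
          | ¬T⇒≡false (λ t → <⇒≯ K<n (<ᵇ⇒< n K t)) = refl

module LDSCells {h : ℕ} {L : Assignment} (lds : IsLDS h L) where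
  open IsLDS lds

  h+2<h+3 : h + 2 < h + 3
  h+2<h+3 = +-monoʳ-< h ≤-refl

  pred-≤-h+2 : ∀ {t} → t ≤ h + 3 → pred t ≤ h + 2
  pred-≤-h+2 le = pred-mono-≤ (≤-trans le (≤-reflexive (+-suc h 2)))

  suc-≤-h+4 : ∀ {t} → t ≤ h + 3 → suc t ≤ h + 4
  suc-≤-h+4 le = ≤-trans (s≤s le) (≤-reflexive (sym (+-suc h 3)))

  interior : ∀ {r c} → 2 ≤ r → 2 ≤ c → r + c ≤ h + 3 → InDiagram h r c
  interior 2≤r 2≤c le = <⇒≤ 2≤r , <⇒≤ 2≤c , ≤-trans (n≤1+n _) (suc-≤-h+4 le)

  row1-nil : ∀ {c} → 1 ≤ c → c ≤ h + 3 → L 1 c ≡ nil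
  row1-nil 1≤c le = row1 _ (≤-refl , 1≤c , suc-≤-h+4 le)

  col1-nil : ∀ {r} → 1 ≤ r → r ≤ h + 3 → L r 1 ≡ nil
  col1-nil {r} 1≤r le = col1 _ (1≤r , ≤-refl , subst (_≤ h + 4) (+-comm 1 r) (suc-≤-h+4 le))

  key-interior : ∀ {r c} → 2 ≤ r → 2 ≤ c → r + c ≤ h + 2 → ∃[ n ] L r c ≡ key n
  key-interior {r} {c} 2≤r 2≤c le =
    map₂ proj₂ (remaining r c 2≤r 2≤c (≤-trans le (<⇒≤ h+2<h+3))
                 (λ (e , _) → <⇒≱ h+2<h+3 (subst (_≤ h + 2) e le)))

  key-column2 : ∀ {r} → 2 ≤ r → r + 2 ≤ h + 3 → ∃[ n ] L r 2 ≡ key n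
  key-column2 {r} 2≤r le =
    map₂ proj₂ (remaining r 2 2≤r ≤-refl le
                 (λ (_ , top) → <⇒≱ (+-monoʳ-< 2 m<h) (subst (_≤ 2 + m) (+-comm h 2) top)))

  inf-or-key : ∀ {r c} → 2 ≤ r → 2 ≤ c → r + c ≤ h + 3 → L r c ≡ inf ⊎ ∃[ n ] L r c ≡ key n
  inf-or-key {r} {c} 2≤r 2≤c le with r + c ≟ h + 3 | h + 2 ≤? c + m
  ... | yes e | yes top = inj₁ (Equivalence.from (diag-second r c 2≤r 2≤c e) top)
  ... | _     | no ¬top = inj₂ (map₂ proj₂ (remaining r c 2≤r 2≤c le (λ (_ , top) → ¬top top)))
  ... | no ¬e | _      = inj₂ (map₂ proj₂ (remaining r c 2≤r 2≤c le (λ (e , _) → ¬e e)))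

  key-position : ∀ {r c k} → InDiagram h r c → L r c ≡ key k → 2 ≤ r × 2 ≤ c × r + c ≤ h + 3
  key-position {zero}       (() , _)
  key-position {_} {zero}   (_ , () , _)
  key-position {suc zero} {c} Dg eq = ⊥-elim (nil≢key (trans (sym (row1 c Dg)) eq))
  key-position {r} {suc zero} Dg eq = ⊥-elim (nil≢key (trans (sym (col1 r Dg)) eq))
  key-position {suc (suc r)} {suc (suc c)} (_ , _ , le) eq = s≤s (s≤s z≤n) , s≤s (s≤s z≤n) , below-top
    where
    not-top : suc (suc r) + suc (suc c) ≢ h + 4
    not-top e = inf≢key (trans (sym (diag-top _ _ (s≤s (s≤s z≤n)) (s≤s (s≤s z≤n)) e)) eq)
    below-top : suc (suc r) + suc (suc c) ≤ h + 3
    below-top = s≤s⁻¹ (≤-trans (≤∧≢⇒< le not-top) (≤-reflexive (+-suc h 3)))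

  key-left-of-key : ∀ {r c r₀ c₀ k} → 2 ≤ c → 2 ≤ r₀ → 2 ≤ c₀ → r₀ + c₀ ≤ h + 3 →
                    r + c ≡ r₀ + c₀ → c < c₀ → L r₀ c₀ ≡ key k → ∃[ n ] L r c ≡ key n × n < k
  key-left-of-key {r} {c} {r₀} {c₀} {k} 2≤c 2≤r₀ 2≤c₀ le e c<c₀ eq =
    n , en , diagInc r c r₀ c₀ n k (interior 2≤r 2≤c le′) (interior 2≤r₀ 2≤c₀ le) e c<c₀ en eq
    where
    le′ : r + c ≤ h + 3
    le′ = ≤-trans (≤-reflexive e) le
    2≤r : 2 ≤ r
    2≤r = ≤-trans 2≤r₀ (<⇒≤ (+-cancelʳ-< c₀ r₀ r (subst (_< r + c₀) e (+-monoʳ-< r c<c₀))))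
    not-top : ¬ (r + c ≡ h + 3 × h + 2 ≤ c + m)
    not-top (e′ , top) =
      inf≢key (trans (sym (Equivalence.from (diag-second r₀ c₀ 2≤r₀ 2≤c₀ (trans (sym e) e′))
                                            (≤-trans top (+-monoˡ-≤ m (<⇒≤ c<c₀))))) eq)
    cell : ∃[ n ] 1 ≤ n × L r c ≡ key n
    cell = remaining r c 2≤r 2≤c le′ not-top
    n : ℕ
    n = proj₁ cell
    en : L r c ≡ key n
    en = proj₂ (proj₂ cell)

module Sorted {h : ℕ} {L : Assignment} (lds : IsLDS h L) (sorted : HSorted h L) where
  open IsLDS lds
  open LDSCells lds

  column2-first : ∀ {r y} → 2 ≤ r → r + 2 ≤ h + 3 → L r 2 ≡ key y → FirstKeyOfDiag L (suc r) y
  column2-first {r} {y} 2≤r le eq =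
    2 , s≤s z≤n , <⇒≤ (s≤s 2≤r) , subst (λ z → L z 2 ≡ key y) (sym (m+n∸n≡m r 1)) eq , none-before
    where
    none-before : ∀ j b → 1 ≤ j → j < 2 → ¬ (L (suc r + 1 ∸ j) j ≡ key b)
    none-before .1 b (s≤s z≤n) (s≤s (s≤s z≤n)) eq′ =
      nil≢key (trans (sym (col1-nil (m≤n+m 1 r) (≤-trans (+-monoʳ-≤ r (n≤1+n 1)) le))) eq′)

  row2-last : ∀ {c y} → 1 ≤ c → suc c ≤ h + 3 → L 2 c ≡ key y → LastKeyOfDiag L (suc c) y
  row2-last {c} {y} 1≤c le eq =
    c , 1≤c , n≤1+n c , subst (λ z → L z c ≡ key y) (sym suc-c+1∸c≡2) eq , none-after
    where
    suc-c+1∸c≡2 : suc c + 1 ∸ c ≡ 2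
    suc-c+1∸c≡2 = trans (cong (_∸ c) (sym (+-suc c 1))) (m+n∸m≡n c 2)
    none-after : ∀ j b → c < j → j ≤ suc c → ¬ (L (suc c + 1 ∸ j) j ≡ key b)
    none-after j b c<j j≤ eq′ with ≤-antisym j≤ c<j
    ... | refl = nil≢key (trans (sym (row1-nil (s≤s z≤n) le))
                                (subst (λ z → L z (suc c) ≡ key b) (m+n∸m≡n c 1) eq′))

  key-≤-row2 : ∀ {c ℓ r₀ c₀ x} → 2 ≤ r₀ → 2 ≤ c₀ → r₀ + c₀ ≡ 2 + c → 2 + c ≤ h + 3 →
               L 2 c ≡ key ℓ → L r₀ c₀ ≡ key x → x ≤ ℓ
  key-≤-row2 {c} {ℓ} {r₀} {c₀} {x} 2≤r₀ 2≤c₀ e le eℓ ex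
    with m≤n⇒m<n∨m≡n (+-cancelˡ-≤ 2 c₀ c (≤-trans (+-monoˡ-≤ c₀ 2≤r₀) (≤-reflexive e)))
  ... | inj₁ c₀<c = <⇒≤ (diagInc r₀ c₀ 2 c x ℓ (interior 2≤r₀ 2≤c₀ (≤-trans (≤-reflexive e) le))
                                                (interior ≤-refl (≤-trans 2≤c₀ (<⇒≤ c₀<c)) le) e c₀<c ex eℓ)
  ... | inj₂ refl with +-cancelʳ-≡ c₀ r₀ 2 e
  ...   | refl = ≤-reflexive (key-injective (trans (sym ex) eℓ))

  column2-above-previous : ∀ {c y r₀ c₀ x} → 2 ≤ c → suc c + 2 ≤ h + 3 → L (suc c) 2 ≡ key y →
                           2 ≤ r₀ → 2 ≤ c₀ → r₀ + c₀ ≡ 2 + c → L r₀ c₀ ≡ key x → x < y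
  column2-above-previous {c} {y} 2≤c le ey 2≤r₀ 2≤c₀ e ex =
    ≤-<-trans (key-≤-row2 2≤r₀ 2≤c₀ e 2+c≤h+3 eℓ ex)
              (proj₂ sorted (suc (suc c)) (s≤s (s≤s 2≤c)) 2+c≤h+2 y ℓ
                     (column2-first (≤-trans 2≤c (n≤1+n c)) le ey)
                     (row2-last (<⇒≤ 2≤c) (≤-trans (n≤1+n (suc c)) 2+c≤h+3) eℓ))
    where
    2+c≤h+2 : 2 + c ≤ h + 2
    2+c≤h+2 = subst (_≤ h + 2) (+-comm c 2) (pred-≤-h+2 le)
    2+c≤h+3 : 2 + c ≤ h + 3
    2+c≤h+3 = ≤-trans 2+c≤h+2 (<⇒≤ h+2<h+3)
    cell : ∃[ ℓ ] L 2 c ≡ key ℓ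
    cell = key-interior ≤-refl 2≤c 2+c≤h+2
    ℓ : ℕ
    ℓ = proj₁ cell
    eℓ : L 2 c ≡ key ℓ
    eℓ = proj₂ cell

  column2-above : ∀ r {y r₀ c₀ x} → r + 2 ≤ h + 3 → L r 2 ≡ key y →
                  2 ≤ r₀ → 2 ≤ c₀ → r₀ + c₀ < r + 2 → L r₀ c₀ ≡ key x → x < y
  column2-above zero _ _ 2≤r₀ 2≤c₀ lt _ = ⊥-elim (<⇒≱ lt (≤-trans (m≤m+n 2 2) (+-mono-≤ 2≤r₀ 2≤c₀)))
  column2-above (suc c) le ey 2≤r₀ 2≤c₀ lt ex with m≤n⇒m<n∨m≡n lt
  ... | inj₂ e = column2-above-previous 2≤c le ey 2≤r₀ 2≤c₀ (trans (suc-injective e) (+-comm c 2)) ex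
    where
    2≤c : 2 ≤ c
    2≤c = +-cancelʳ-≤ 2 2 c (subst (4 ≤_) (suc-injective e) (+-mono-≤ 2≤r₀ 2≤c₀))
  ... | inj₁ lt′ =
    <-trans (column2-above c le′ ey′ 2≤r₀ 2≤c₀ (s≤s⁻¹ lt′) ex)
            (colInc c (suc c) 2 y′ _ (interior 2≤c ≤-refl le′) (interior (≤-trans 2≤c (n≤1+n c)) ≤-refl le)
                    ≤-refl ey′ ey)
    where
    2≤c : 2 ≤ c
    2≤c = +-cancelʳ-≤ 2 2 c (≤-trans (+-mono-≤ 2≤r₀ 2≤c₀) (<⇒≤ (s≤s⁻¹ lt′)))
    le′ : c + 2 ≤ h + 3
    le′ = ≤-trans (n≤1+n _) le
    cell : ∃[ y′ ] L c 2 ≡ key y′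
    cell = key-column2 2≤c le′
    y′ : ℕ
    y′ = proj₁ cell
    ey′ : L c 2 ≡ key y′
    ey′ = proj₂ cell

  module Search (K : ℕ) where

    -- Diagonals are indexed by the common value t = r + c of their cells (the paper's diagonal t − 1).
    KeysBelow : ℕ → Set
    KeysBelow t = ∀ {r c n} → 2 ≤ r → 2 ≤ c → r + c ≡ t → L r c ≡ key n → n < K

    search-below : ∀ {t} r c → 2 ≤ c → r + c ≡ t → t ≤ h + 2 → KeysBelow t →
                   Runs (d ∷ []) (searchFrom L K r c)
    search-below zero c _ _ _ _ = []
    search-below (suc zero) c 2≤c e le _
      rewrite search-nil L K (row1-nil (<⇒≤ 2≤c)
                (≤-trans (n≤1+n c) (≤-trans (≤-reflexive e) (≤-trans le (<⇒≤ h+2<h+3))))) = []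
    search-below (suc (suc r)) c 2≤c e le below =
      subst (Runs _) (sym (search-right L K (proj₂ cell) (below (s≤s (s≤s z≤n)) 2≤c e (proj₂ cell))))
        (here (search-below (suc r) (suc c) (≤-trans 2≤c (n≤1+n c)) (trans (+-suc (suc r) c) e) le below))
      where
      cell : ∃[ n ] L (suc (suc r)) c ≡ key n
      cell = key-interior (s≤s (s≤s z≤n)) 2≤c (≤-trans (≤-reflexive e) le)

    module NotKey (not-key : ¬ IsProperKey h L K) where

      search-diagonal : ∀ {t} r c → 2 ≤ c → r + c ≡ t → t ≤ h + 3 → KeysBelow (pred t) →
                        Runs (d ∷ D ∷ d ∷ []) (searchFrom L K r c)
      search-diagonal-at : ∀ {t} r c → 1 ≤ r → 2 ≤ c → suc r + c ≡ t → t ≤ h + 3 → KeysBelow (pred t) →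
                           L (suc r) c ≡ inf ⊎ ∃[ n ] L (suc r) c ≡ key n →
                           Runs (d ∷ D ∷ d ∷ []) (searchFrom L K (suc r) c)

      search-diagonal zero _ _ _ _ _ = []
      search-diagonal (suc zero) c 2≤c e le _
        rewrite search-nil L K (row1-nil (<⇒≤ 2≤c) (≤-trans (n≤1+n c) (≤-trans (≤-reflexive e) le))) = []
      search-diagonal (suc (suc r)) c 2≤c e le below =
        search-diagonal-at (suc r) c (s≤s z≤n) 2≤c e le below
          (inf-or-key (s≤s (s≤s z≤n)) 2≤c (≤-trans (≤-reflexive e) le))

      search-diagonal-at r c _ 2≤c e le below (inj₁ e∞) =
        subst (Runs _) (sym (search-inf L K e∞))
          (next (here (next (search-below r c 2≤c (cong pred e) (pred-≤-h+2 le) below))))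
      search-diagonal-at r c 1≤r 2≤c e le below (inj₂ (n , en)) with <-cmp n K
      ... | tri< n<K _ _ =
        subst (Runs _) (sym (search-right L K en n<K))
          (here (search-diagonal r (suc c) (≤-trans 2≤c (n≤1+n c)) (trans (+-suc r c) e) le below))
      ... | tri≈ _ refl _ =
        ⊥-elim (not-key (suc r , c , interior (s≤s 1≤r) 2≤c (≤-trans (≤-reflexive e) le) , en))
      ... | tri> _ _ K<n =
        subst (Runs _) (sym (search-down L K en K<n))
          (next (here (next (search-below r c 2≤c (cong pred e) (pred-≤-h+2 le) below))))

      search-column2 : ∀ r → r + 2 ≤ h + 3 → Runs (D ∷ d ∷ D ∷ d ∷ []) (searchFrom L K r 2)
      search-column2-at : ∀ r → 1 ≤ r → suc r + 2 ≤ h + 3 → ∃[ n ] L (suc r) 2 ≡ key n →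
                          Runs (D ∷ d ∷ D ∷ d ∷ []) (searchFrom L K (suc r) 2)

      search-column2 zero _ = []
      search-column2 (suc zero) le rewrite search-nil L K (row1-nil (s≤s z≤n) (≤-trans (n≤1+n 2) le)) = []
      search-column2 (suc (suc r)) le =
        search-column2-at (suc r) (s≤s z≤n) le (key-column2 (s≤s (s≤s z≤n)) le)

      search-column2-at r 1≤r le (n , en) with <-cmp n K
      ... | tri< n<K _ _ = next (search-diagonal (suc r) 2 ≤-refl refl le below)
        where
        below : KeysBelow (r + 2)
        below 2≤r₀ 2≤c₀ e ex =
          <-trans (column2-above (suc r) le en 2≤r₀ 2≤c₀ (≤-reflexive (cong suc e)) ex) n<K
      ... | tri≈ _ refl _ = ⊥-elim (not-key (suc r , 2 , interior (s≤s 1≤r) ≤-refl le , en))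
      ... | tri> _ _ K<n =
        subst (Runs _) (sym (search-down L K en K<n)) (here (search-column2 r (≤-trans (n≤1+n _) le)))

    module KeyAt {r₀ c₀} (2≤r₀ : 2 ≤ r₀) (2≤c₀ : 2 ≤ c₀) (le₀ : r₀ + c₀ ≤ h + 3)
                 (eK : L r₀ c₀ ≡ key K) where

      2<r₀+c₀ : 2 < r₀ + c₀
      2<r₀+c₀ = ≤-trans (n≤1+n 3) (+-mono-≤ 2≤r₀ 2≤c₀)

      search-to-key : ∀ r c → 2 ≤ c → r + c ≡ r₀ + c₀ → c ≤ c₀ → Runs (d ∷ []) (searchFrom L K r c)
      search-to-key-at : ∀ r c → 2 ≤ c → suc r + c ≡ r₀ + c₀ → c < c₀ ⊎ c ≡ c₀ →
                         Runs (d ∷ []) (searchFrom L K (suc r) c)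

      search-to-key zero _ _ _ _ = []
      search-to-key (suc r) c 2≤c e c≤c₀ = search-to-key-at r c 2≤c e (m≤n⇒m<n∨m≡n c≤c₀)

      search-to-key-at r c 2≤c e (inj₂ refl) =
        subst (Runs _) (sym (search-found L K (subst (λ z → L z c ≡ key K) (sym r≡r₀) eK))) []
        where
        r≡r₀ : suc r ≡ r₀
        r≡r₀ = +-cancelʳ-≡ c (suc r) r₀ e
      search-to-key-at r c 2≤c e (inj₁ c<c₀) with key-left-of-key 2≤c 2≤r₀ 2≤c₀ le₀ e c<c₀ eK
      ... | n , en , n<K =
        subst (Runs _) (sym (search-right L K en n<K))
          (here (search-to-key r (suc c) (≤-trans 2≤c (n≤1+n c)) (trans (+-suc r c) e) c<c₀))

      search-column2 : ∀ r → r + 2 ≤ h + 3 → r₀ + c₀ ≤ r + 2 → Runs (D ∷ d ∷ []) (searchFrom L K r 2)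
      search-column2-at : ∀ r → suc r + 2 ≤ h + 3 → r₀ + c₀ < suc r + 2 ⊎ r₀ + c₀ ≡ suc r + 2 →
                          Runs (D ∷ d ∷ []) (searchFrom L K (suc r) 2)

      search-column2 zero _ below = ⊥-elim (≤⇒≯ below 2<r₀+c₀)
      search-column2 (suc r) le below = search-column2-at r le (m≤n⇒m<n∨m≡n below)

      search-column2-at r le (inj₂ e) = next (search-to-key (suc r) 2 ≤-refl (sym e) 2≤c₀)
      search-column2-at zero le (inj₁ lt) = ⊥-elim (≤⇒≯ (s≤s⁻¹ lt) 2<r₀+c₀)
      search-column2-at (suc r) le (inj₁ lt) =
        subst (Runs _) (sym (search-down L K (proj₂ cell) K<y))
          (here (search-column2 (suc r) (≤-trans (n≤1+n _) le) (s≤s⁻¹ lt)))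
        where
        cell : ∃[ y ] L (suc (suc r)) 2 ≡ key y
        cell = key-column2 (s≤s (s≤s z≤n)) le
        K<y : K < proj₁ cell
        K<y = column2-above (suc (suc r)) le (proj₂ cell) 2≤r₀ 2≤c₀ lt eK

corollary5 : ∀ (h : ℕ) (L : Assignment) → IsLDS h L → HSorted h L →
    (∀ K → IsProperKey h L K → J h L K ≤ 2) ×
    (∀ K → 1 ≤ K → ¬ IsProperKey h L K → J h L K ≤ 4)
corollary5 h L lds sorted = key-blocks , non-key-blocks
  where
  open LDSCells lds
  open Sorted lds sorted

  start : h + 1 + 2 ≡ h + 3
  start = +-assoc h 1 2

  key-blocks : ∀ K → IsProperKey h L K → J h L K ≤ 2
  key-blocks K (r₀ , c₀ , inside , eK) with key-position inside eK
  ... | 2≤r₀ , 2≤c₀ , le₀ =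
    blocks-Runs (Search.KeyAt.search-column2 K 2≤r₀ 2≤c₀ le₀ eK (h + 1)
                   (≤-reflexive start) (≤-trans le₀ (≤-reflexive (sym start))))

  non-key-blocks : ∀ K → 1 ≤ K → ¬ IsProperKey h L K → J h L K ≤ 4
  non-key-blocks K _ not-key = blocks-Runs (Search.NotKey.search-column2 K not-key (h + 1) (≤-reflexive start))
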